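{- Let $I=(P,F,G,S)$ be an instance of Seat Arrangement with S-utility whose seat graph $G$ is a single cycle with at least four vertices, and whose preferences are $1$-dimensional with unique positions. Then for every arrangement $\sigma$ there is an agent that envies one of its neighbours under $\sigma$.
   Context: An instance $I=(P,F,G,U)$ of Seat Arrangement consists of a finite set $P$ of agents; for each $p\in P$ a valuation function $f_p:P\setminus\{p\}\to\mathbb{R}$; an undirected simple graph $G$ (the seat graph) with $|V(G)|=|P|$; and a utility type. An arrangement is a bijection $\sigma:P\to V(G)$. Under S-utility, $u_\sigma(p)=\sum_{v\in N(\sigma(p))} f_p(\sigma^{ -1}(v))$, where $N(\sigma(p))$ is the set of neighbours of $\sigma(p)$ in $G$. For distinct $p,q$, $\sigma^{p\leftrightarrow q}$ is $\sigma$ with the seats of $p$ and $q$ swapped; $p$ envies $q$ under $\sigma$ if $u_\sigma(p)<u_{\sigma^{p\leftrightarrow q}}(p)$. A neighbour of $p$ under $\sigma$ is an agent $q$ with $\sigma(q)\in N(\sigma(p))$. Preferences are $1$-dimensional if each agent $p$ has a location $l_p\in\mathbb{R}$, $d(p,q)=|l_p-l_q|$, $D=\max_p l_p-\min_p l_p$, and $f_p(q)=D-d(p,q)+1$; positions are unique if no two agents share a location.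
   Formalization: The agents' locations $l_p$ take values in the rationals rather than in ℝ. -}

module Defs where

open import Data.Nat using (ℕ; zero; suc; _≡ᵇ_)
open import Data.Fin using (Fin; toℕ)
open import Data.Bool using (Bool; true; false; _∨_; _∧_; if_then_else_)
open import Data.List using (List; []; _∷_; foldr; map)
open import Data.Fin using (_≟_)
open import Relation.Nullary using (yes; no)
open import Data.List using () renaming (allFin to agents)
open import Data.Rational using (ℚ; 0ℚ; 1ℚ; _+_; _-_; ∣_∣; _⊔_; _⊓_; _<_)
open import Relation.Binary.PropositionalEquality using (_≡_; _≢_)
open import Function.Bundles using (_↔_; Inverse)
open import Data.Product using (∃₂; _×_)

-- Agents and seats are both Fin n (|V(G)| = |P| = n).
-- A seat graph is given by a Boolean adjacency relation on seats.
SeatGraph : ℕ → Set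
SeatGraph n = Fin n → Fin n → Bool

-- The cycle C_n on seats 0,1,...,n-1: i ~ j iff j = i+1, i = j+1,
-- or {i,j} = {0, n-1}.  (For n ≥ 3 this is exactly the simple n-cycle.)
cycleGraph : (n : ℕ) → SeatGraph n
cycleGraph n i j =
  (suc (toℕ i) ≡ᵇ toℕ j) ∨ (suc (toℕ j) ≡ᵇ toℕ i)
  ∨ ((toℕ i ≡ᵇ 0) ∧ (suc (toℕ j) ≡ᵇ n))
  ∨ ((toℕ j ≡ᵇ 0) ∧ (suc (toℕ i) ≡ᵇ n))

sumℚ : List ℚ → ℚ
sumℚ = foldr _+_ 0ℚ

maxℚ : List ℚ → ℚ
maxℚ []       = 0ℚ
maxℚ (x ∷ xs) = foldr _⊔_ x xs

minℚ : List ℚ → ℚ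
minℚ []       = 0ℚ
minℚ (x ∷ xs) = foldr _⊓_ x xs

-- 1-dimensional preferences given by locations l : agents → ℚ.
-- D = max_p l_p - min_p l_p
diam : {n : ℕ} → (Fin n → ℚ) → ℚ
diam {n} l = maxℚ (map l (agents n)) - minℚ (map l (agents n))

val1D : {n : ℕ} → (Fin n → ℚ) → Fin n → Fin n → ℚ
val1D l p q = diam l - ∣ l p - l q ∣ + 1ℚ

-- Placements of agents into seats (not necessarily bijective, so that
-- swaps can be written directly); an arrangement is a bijection.
Placement : ℕ → Set
Placement n = Fin n → Fin n

Arrangement : ℕ → Set
Arrangement n = Fin n ↔ Fin n

-- S-utility: u_σ(p) = Σ_{q : σ(q) ∈ N(σ(p))} f_p(q)
-- (the sum over neighbouring seats v of f_p(σ⁻¹ v), reindexed by agents)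
utility : {n : ℕ} → SeatGraph n → (Fin n → Fin n → ℚ) → Placement n → Fin n → ℚ
utility {n} G f σ p =
  sumℚ (map (λ q → if G (σ p) (σ q) then f p q else 0ℚ) (agents n))

swap : {n : ℕ} → Placement n → Fin n → Fin n → Placement n
swap σ p q r with r ≟ p | r ≟ q
... | yes _ | _ = σ q
... | no _ | yes _ = σ p
... | no _ | no _ = σ r

Envies : {n : ℕ} → SeatGraph n → (Fin n → Fin n → ℚ) → Placement n → Fin n → Fin n → Set
Envies G f σ p q = p ≢ q × utility G f σ p < utility G f (swap σ p q) p

Neighbour : {n : ℕ} → SeatGraph n → Placement n → Fin n → Fin n → Set
Neighbour G σ p q = G (σ p) (σ q) ≡ true

-- Let a be the leftmost agent, b and c its neighbours with l b < l c, and
-- b′ the other neighbour of b.  As the cycle has length at least 4, b′ ≠ c.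
-- Under 1-dimensional preferences nearer agents are strictly preferred.  If
-- b′ lies left of c, then a envies b: the swap replaces c by b′ among a's
-- neighbours, and l a ≤ l b′ < l c.  Otherwise l b < l c < l b′, and b envies
-- a: the swap replaces b′ by c among b's neighbours.

module Submission where

open import Defs
open import Algebra.Properties.AbelianGroup using (⁻¹-anti-homo‿-)
open import Data.Bool using (true; false; T; _∨_; _∧_; if_then_else_)
open import Data.Bool.Properties using (T-≡; T-∨; T-∧)
open import Data.Empty using (⊥-elim)
open import Data.Fin using (Fin; zero; suc; toℕ; fromℕ<; _≟_)
open import Data.Fin.Properties using (toℕ<n; toℕ-fromℕ<; toℕ-injective; suc-injective)
open import Data.List using (map; allFin)
open import Data.List.Properties using (map-tabulate)
open import Data.List.Relation.Unary.All using (lookup)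
open import Data.List.Membership.Propositional.Properties using (∈-allFin)
open import Data.Nat using (ℕ; zero; suc; _≤_; s≤s; z≤n; _≡ᵇ_)
import Data.Nat as ℕ
import Data.Nat.Properties as ℕ
open import Data.Product using (_×_; _,_; ∃; ∃₂; proj₂)
open import Data.Rational using (ℚ; 0ℚ; 1ℚ; _+_; _-_; -_; ∣_∣; _<_)
import Data.Rational as ℚ
open import Data.Rational.Properties
  using ( ≤-decTotalOrder; <-cmp; <⇒≤; ≤-<-trans; +-monoˡ-≤; +-monoˡ-<; +-monoʳ-<
        ; neg-antimono-<; ∣-p∣≡∣p∣; 0≤p⇒∣p∣≡p; +-inverseʳ; +-identityˡ; +-identityʳ
        ; +-comm; +-0-abelianGroup )
open import Data.Sum using (_⊎_; inj₁; inj₂; [_,_]′)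
import Data.Sum as Sum
open import Function using (_∘_; _on_; id; flip)
open import Function.Bundles using (Inverse; Injection; Equivalence; _↔_; _⇔_; mk⇔)
open import Function.Definitions using (Injective)
open import Function.Properties.Inverse using (↔⇒↣)
open import Level using (0ℓ)
open import Relation.Binary using (Rel; Symmetric; DecTotalOrder; tri<; tri≈; tri>)
open import Relation.Binary.PropositionalEquality
open import Relation.Nullary using (¬_; Dec; yes; no)

open import Data.List.Extrema (DecTotalOrder.totalOrder ≤-decTotalOrder)
  using (argmin; f[argmin]≤f[xs])

∣p-q∣≡q-p : ∀ {p q} → p ℚ.≤ q → ∣ p - q ∣ ≡ q - p
∣p-q∣≡q-p {p} {q} p≤q = begin
  ∣ p - q ∣     ≡⟨ ∣-p∣≡∣p∣ (p - q) ⟨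
  ∣ - (p - q) ∣ ≡⟨ cong ∣_∣ (⁻¹-anti-homo‿- +-0-abelianGroup p q) ⟩
  ∣ q - p ∣     ≡⟨ 0≤p⇒∣p∣≡p 0≤q-p ⟩
  q - p         ∎
  where
  open ≡-Reasoning
  0≤q-p : 0ℚ ℚ.≤ q - p
  0≤q-p = subst (ℚ._≤ q - p) (+-inverseʳ p) (+-monoˡ-≤ (- p) p≤q)

∣p-q∣<∣p-r∣ : ∀ {p q r} → p ℚ.≤ q → q < r → ∣ p - q ∣ < ∣ p - r ∣
∣p-q∣<∣p-r∣ {p} {q} {r} p≤q q<r =
  subst₂ _<_ (sym (∣p-q∣≡q-p p≤q)) (sym (∣p-q∣≡q-p (<⇒≤ (≤-<-trans p≤q q<r))))
    (+-monoˡ-< (- p) q<r)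

val1D-nearer : ∀ {n} (l : Fin n → ℚ) {p q r} → l p ℚ.≤ l q → l q < l r →
  val1D l p r < val1D l p q
val1D-nearer l lp≤lq lq<lr =
  +-monoˡ-< 1ℚ (+-monoʳ-< (diam l) (neg-antimono-< (∣p-q∣<∣p-r∣ lp≤lq lq<lr)))

record NeighbourPair {A : Set} (_~_ : Rel A 0ℓ) (i u v : A) : Set where
  field
    distinct    : u ≢ v
    adjacentˡ   : i ~ u
    adjacentʳ   : i ~ v
    exhaustive  : ∀ {t} → i ~ t → t ≡ u ⊎ t ≡ v

module _ {A : Set} {_~_ : Rel A 0ℓ} where

  NeighbourPair-flip : ∀ {i u v} → NeighbourPair _~_ i u v → NeighbourPair _~_ i v u
  NeighbourPair-flip np = record
    { distinct   = distinct ∘ sym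
    ; adjacentˡ  = adjacentʳ
    ; adjacentʳ  = adjacentˡ
    ; exhaustive = Sum.swap ∘ exhaustive
    }
    where open NeighbourPair np

  NeighbourPair-through : ∀ {i u v t} → NeighbourPair _~_ i u v → i ~ t →
    ∃ (NeighbourPair _~_ i t)
  NeighbourPair-through {v = v} np i~t with NeighbourPair.exhaustive np i~t
  ... | inj₁ refl = v , np
  ... | inj₂ refl = _ , NeighbourPair-flip np

  NeighbourPair-transport : ∀ {B : Set} {_≈_ : Rel B 0ℓ} (f : B → A) → Injective _≡_ _≡_ f →
    (∀ {p q} → p ≈ q ⇔ f p ~ f q) →
    ∀ {p u v} → NeighbourPair _~_ (f p) (f u) (f v) → NeighbourPair _≈_ p u v
  NeighbourPair-transport f f-injective ≈⇔~ np = record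
    { distinct   = distinct ∘ cong f
    ; adjacentˡ  = Equivalence.from ≈⇔~ adjacentˡ
    ; adjacentʳ  = Equivalence.from ≈⇔~ adjacentʳ
    ; exhaustive = Sum.map f-injective f-injective ∘ exhaustive ∘ Equivalence.to ≈⇔~
    }
    where open NeighbourPair np

-- For finite A: a disjoint union of cycles of length at least 4.
record TriangleFreeTwoRegular {A : Set} (_~_ : Rel A 0ℓ) : Set where
  field
    symmetric    : Symmetric _~_
    irreflexive  : ∀ {i} → ¬ i ~ i
    triangleFree : ∀ {i j k} → i ~ j → j ~ k → ¬ i ~ k
    neighbours   : ∀ i → ∃₂ (NeighbourPair _~_ i)

TriangleFreeTwoRegular-on : ∀ {A B : Set} {_~_ : Rel A 0ℓ} (σ : B ↔ A) →
  TriangleFreeTwoRegular _~_ → TriangleFreeTwoRegular (_~_ on Inverse.to σ)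
TriangleFreeTwoRegular-on {_~_ = _~_} σ reg = record
  { symmetric    = symmetric
  ; irreflexive  = irreflexive
  ; triangleFree = triangleFree
  ; neighbours   = neighbours′
  }
  where
  open TriangleFreeTwoRegular reg
  open Inverse σ
  neighbours′ : ∀ p → ∃₂ (NeighbourPair (_~_ on to) p)
  neighbours′ p with neighbours (to p)
  ... | x , y , np = from x , from y ,
    NeighbourPair-transport to (Injection.injective (↔⇒↣ σ)) (mk⇔ id id)
      (subst₂ (NeighbourPair _~_ (to p)) (sym (strictlyInverseˡ x)) (sym (strictlyInverseˡ y)) np)

≢-suc : ∀ {n} {s t : Fin n} → s ≢ t → suc s ≢ suc t
≢-suc s≢t = s≢t ∘ suc-injective

∑ : ∀ {n} → (Fin n → ℚ) → ℚ
∑ F = sumℚ (map F (allFin _))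

∑-suc : ∀ {n} (F : Fin (suc n) → ℚ) → ∑ F ≡ F zero + ∑ (F ∘ suc)
∑-suc F = cong (λ xs → F zero + sumℚ xs)
  (trans (map-tabulate suc F) (sym (map-tabulate id (F ∘ suc))))

∑-zero : ∀ {n} {F : Fin n → ℚ} → (∀ t → F t ≡ 0ℚ) → ∑ F ≡ 0ℚ
∑-zero {zero}  F≡0 = refl
∑-zero {suc n} {F} F≡0 = begin
  ∑ F                   ≡⟨ ∑-suc F ⟩
  F zero + ∑ (F ∘ suc)  ≡⟨ cong₂ _+_ (F≡0 zero) (∑-zero (F≡0 ∘ suc)) ⟩
  0ℚ + 0ℚ               ≡⟨ +-identityˡ 0ℚ ⟩
  0ℚ                    ∎
  where open ≡-Reasoning

∑-single : ∀ {n} {F : Fin n → ℚ} {u} → (∀ t → t ≢ u → F t ≡ 0ℚ) → ∑ F ≡ F u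
∑-single {suc n} {F} {zero} F≡0 = begin
  ∑ F                   ≡⟨ ∑-suc F ⟩
  F zero + ∑ (F ∘ suc)  ≡⟨ cong (F zero +_) (∑-zero (λ t → F≡0 (suc t) λ ())) ⟩
  F zero + 0ℚ           ≡⟨ +-identityʳ (F zero) ⟩
  F zero                ∎
  where open ≡-Reasoning
∑-single {suc n} {F} {suc u} F≡0 = begin
  ∑ F                   ≡⟨ ∑-suc F ⟩
  F zero + ∑ (F ∘ suc)  ≡⟨ cong₂ _+_ (F≡0 zero λ ()) (∑-single (λ t → F≡0 (suc t) ∘ ≢-suc)) ⟩
  0ℚ + F (suc u)        ≡⟨ +-identityˡ (F (suc u)) ⟩
  F (suc u)             ∎
  where open ≡-Reasoning

∑-pair : ∀ {n} {F : Fin n → ℚ} {u v} → u ≢ v → (∀ t → t ≢ u → t ≢ v → F t ≡ 0ℚ) →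
  ∑ F ≡ F u + F v
∑-pair {suc n} {F} {zero}  {zero}  u≢v F≡0 = ⊥-elim (u≢v refl)
∑-pair {suc n} {F} {zero}  {suc v} u≢v F≡0 =
  trans (∑-suc F) (cong (F zero +_) (∑-single (λ t → F≡0 (suc t) (λ ()) ∘ ≢-suc)))
∑-pair {suc n} {F} {suc u} {zero}  u≢v F≡0 = begin
  ∑ F                   ≡⟨ ∑-suc F ⟩
  F zero + ∑ (F ∘ suc)  ≡⟨ cong (F zero +_) (∑-single (λ t → flip (F≡0 (suc t)) (λ ()) ∘ ≢-suc)) ⟩
  F zero + F (suc u)    ≡⟨ +-comm (F zero) (F (suc u)) ⟩
  F (suc u) + F zero    ∎
  where open ≡-Reasoning
∑-pair {suc n} {F} {suc u} {suc v} u≢v F≡0 = begin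
  ∑ F                           ≡⟨ ∑-suc F ⟩
  F zero + ∑ (F ∘ suc)          ≡⟨ cong₂ _+_ (F≡0 zero (λ ()) (λ ())) (∑-pair (u≢v ∘ cong suc) F≡0′) ⟩
  0ℚ + (F (suc u) + F (suc v))  ≡⟨ +-identityˡ _ ⟩
  F (suc u) + F (suc v)         ∎
  where
  open ≡-Reasoning
  F≡0′ : ∀ t → t ≢ u → t ≢ v → F (suc t) ≡ 0ℚ
  F≡0′ t t≢u t≢v = F≡0 (suc t) (≢-suc t≢u) (≢-suc t≢v)

Adjacent : ∀ {n} → SeatGraph n → Rel (Fin n) 0ℓ
Adjacent G i j = G i j ≡ true

utility-NeighbourPair : ∀ {n} {G : SeatGraph n} {f : Fin n → Fin n → ℚ} {τ : Placement n}
  {p u v} → NeighbourPair (Adjacent G on τ) p u v → utility G f τ p ≡ f p u + f p v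
utility-NeighbourPair {G = G} {f} {τ} {p} {u} {v} np =
  trans (∑-pair distinct off-pair) (cong₂ _+_ (at adjacentˡ) (at adjacentʳ))
  where
  open NeighbourPair np
  F : Fin _ → ℚ
  F q = if G (τ p) (τ q) then f p q else 0ℚ
  at : ∀ {q} → G (τ p) (τ q) ≡ true → F q ≡ f p q
  at adj rewrite adj = refl
  off-pair : ∀ t → t ≢ u → t ≢ v → F t ≡ 0ℚ
  off-pair t t≢u t≢v with G (τ p) (τ t) in adj
  ... | false = refl
  ... | true  = ⊥-elim (Sum.[ t≢u , t≢v ] (exhaustive adj))

module _ {n} (σ : Placement n) (p q : Fin n) where

  swap-left : swap σ p q p ≡ σ q
  swap-left with p ≟ p
  ... | yes _   = refl
  ... | no p≢p  = ⊥-elim (p≢p refl)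

  swap-right : p ≢ q → swap σ p q q ≡ σ p
  swap-right p≢q with q ≟ p | q ≟ q
  ... | yes q≡p | _      = ⊥-elim (p≢q (sym q≡p))
  ... | no _    | yes _  = refl
  ... | no _    | no q≢q = ⊥-elim (q≢q refl)

  swap-other : ∀ {r} → r ≢ p → r ≢ q → swap σ p q r ≡ σ r
  swap-other {r} r≢p r≢q with r ≟ p | r ≟ q
  ... | yes r≡p | _       = ⊥-elim (r≢p r≡p)
  ... | no _    | yes r≡q = ⊥-elim (r≢q r≡q)
  ... | no _    | no _    = refl

module _ {n} {G : SeatGraph n} (G-irreflexive : ∀ {i} → ¬ Adjacent G i i) {π : Placement n} where

  NeighbourPair-swap : ∀ {p q r} → NeighbourPair (Adjacent G on π) q p r →
    NeighbourPair (Adjacent G on swap π p q) p q r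
  NeighbourPair-swap {p} {q} {r} np = record
    { distinct   = λ { refl → G-irreflexive adjacentʳ }
    ; adjacentˡ  = subst₂ (Adjacent G) (sym (swap-left π p q)) (sym (swap-right π p q p≢q))
                     adjacentˡ
    ; adjacentʳ  = subst₂ (Adjacent G) (sym (swap-left π p q)) (sym (swap-other π p q r≢p r≢q))
                     adjacentʳ
    ; exhaustive = exhaustive′
    }
    where
    open NeighbourPair np
    p≢q : p ≢ q
    p≢q refl = G-irreflexive adjacentˡ
    r≢p : r ≢ p
    r≢p = distinct ∘ sym
    r≢q : r ≢ q
    r≢q refl = G-irreflexive adjacentʳ
    exhaustive′ : ∀ {t} → Adjacent G (swap π p q p) (swap π p q t) → t ≡ q ⊎ t ≡ r
    exhaustive′ {t} adj = classify (t ≟ p) (t ≟ q)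
      where
      classify : Dec (t ≡ p) → Dec (t ≡ q) → t ≡ q ⊎ t ≡ r
      classify (yes t≡p) _         =
        ⊥-elim (G-irreflexive (subst (Adjacent G _ ∘ swap π p q) t≡p adj))
      classify (no _)    (yes t≡q) = inj₁ t≡q
      classify (no t≢p)  (no t≢q)  =
        Sum.map₁ (⊥-elim ∘ t≢p)
          (exhaustive (subst₂ (Adjacent G) (swap-left π p q) (swap-other π p q t≢p t≢q) adj))

  envies-neighbour : ∀ {f : Fin n → Fin n → ℚ} {p q r w} →
    NeighbourPair (Adjacent G on π) p q w → NeighbourPair (Adjacent G on π) q p r →
    f p w < f p r → Envies G f π p q
  envies-neighbour {f} {p} {q} np nq fpw<fpr =
    (λ { refl → G-irreflexive (NeighbourPair.adjacentˡ np) }) ,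
    subst₂ _<_ (sym (utility-NeighbourPair {G = G} {f} {π} np))
      (sym (utility-NeighbourPair {G = G} {f} {swap π p q} (NeighbourPair-swap nq)))
      (+-monoʳ-< (f p q) fpw<fpr)

module _ {m} {G : SeatGraph (suc m)} (G-regular : TriangleFreeTwoRegular (Adjacent G))
         (l : Fin (suc m) → ℚ) (l-injective : Injective _≡_ _≡_ l)
         (σ : Arrangement (suc m)) where

  private
    π : Placement (suc m)
    π = Inverse.to σ
    open TriangleFreeTwoRegular G-regular using () renaming (irreflexive to G-irreflexive)
    open TriangleFreeTwoRegular (TriangleFreeTwoRegular-on σ G-regular)
      using (symmetric; triangleFree; neighbours)

    H : Rel (Fin (suc m)) 0ℓ
    H = Adjacent G on π

    envies : ∀ {p q r w} → NeighbourPair H p q w → NeighbourPair H q p r →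
      val1D l p w < val1D l p r → Envies G (val1D l) π p q
    envies = envies-neighbour {G = G} G-irreflexive {π = π} {f = val1D l}

  EnviousNeighbours : Set
  EnviousNeighbours = ∃₂ λ p q → Neighbour G π p q × Envies G (val1D l) π p q

  envy-beside-leftmost : ∀ {a b c} → (∀ q → l a ℚ.≤ l q) →
    NeighbourPair H a b c → l b < l c → EnviousNeighbours
  envy-beside-leftmost {a} {b} {c} a-leftmost na lb<lc =
    compare (NeighbourPair-through (proj₂ (proj₂ (neighbours b))) (symmetric a~b))
    where
    a~b : H a b
    a~b = NeighbourPair.adjacentˡ na
    a~c : H a c
    a~c = NeighbourPair.adjacentʳ na
    compare : ∃ (NeighbourPair H b a) → EnviousNeighbours
    compare (b′ , nb) with <-cmp (l b′) (l c)
    ... | tri< lb′<lc _ _ = a , b , a~b , envies na nb (val1D-nearer l (a-leftmost b′) lb′<lc)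
    ... | tri≈ _ lb′≡lc _ = ⊥-elim (triangleFree a~b (NeighbourPair.adjacentʳ nb)
                                      (subst (H a) (sym (l-injective lb′≡lc)) a~c))
    ... | tri> _ _ lc<lb′ = b , a , NeighbourPair.adjacentˡ nb ,
                            envies nb na (val1D-nearer l (<⇒≤ lb<lc) lc<lb′)

  private
    leftmost : Fin (suc m)
    leftmost = argmin l zero (allFin _)

    leftmost-minimal : ∀ q → l leftmost ℚ.≤ l q
    leftmost-minimal q = lookup (f[argmin]≤f[xs] {f = l} zero (allFin _)) (∈-allFin q)

  envious-neighbours : EnviousNeighbours
  envious-neighbours with neighbours leftmost
  ... | u , v , na with <-cmp (l u) (l v)
  ... | tri< lu<lv _ _ = envy-beside-leftmost leftmost-minimal na lu<lv
  ... | tri≈ _ lu≡lv _ = ⊥-elim (NeighbourPair.distinct na (l-injective lu≡lv))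
  ... | tri> _ _ lv<lu = envy-beside-leftmost leftmost-minimal (NeighbourPair-flip na) lv<lu

-- Adjacency on the n-cycle 0, 1, …, n - 1 over ℕ.  The length n is an index,
-- so that unification alone discharges irreflexivity and triangle-freeness.
data CycleAdj : ℕ → ℕ → ℕ → Set where
  step   : ∀ {n a} → suc a ℕ.< n → CycleAdj n a (suc a)
  unstep : ∀ {n a} → suc a ℕ.< n → CycleAdj n (suc a) a
  wrapˡ  : ∀ {b} → CycleAdj (suc b) 0 b
  wrapʳ  : ∀ {a} → CycleAdj (suc a) a 0

CycleAdj-sym : ∀ {n} → Symmetric (CycleAdj n)
CycleAdj-sym (step lt)   = unstep lt
CycleAdj-sym (unstep lt) = step lt
CycleAdj-sym wrapˡ       = wrapʳ
CycleAdj-sym wrapʳ       = wrapˡ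

CycleAdj-<ʳ : ∀ {n a b} → CycleAdj n a b → b ℕ.< n
CycleAdj-<ʳ (step lt)   = lt
CycleAdj-<ʳ (unstep lt) = ℕ.<-trans (ℕ.n<1+n _) lt
CycleAdj-<ʳ wrapˡ       = ℕ.n<1+n _
CycleAdj-<ʳ wrapʳ       = ℕ.z<s

CycleAdj-irrefl : ∀ {k a} → ¬ CycleAdj (4 ℕ.+ k) a a
CycleAdj-irrefl ()

CycleAdj-triangleFree : ∀ {k a b c} →
  CycleAdj (4 ℕ.+ k) a b → CycleAdj (4 ℕ.+ k) b c → ¬ CycleAdj (4 ℕ.+ k) a c
CycleAdj-triangleFree (step _)   (step _)   ()
CycleAdj-triangleFree (step _)   (unstep _) ()
CycleAdj-triangleFree (step _)   wrapʳ      ()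
CycleAdj-triangleFree (unstep _) (step _)   ()
CycleAdj-triangleFree (unstep _) (unstep _) ()
CycleAdj-triangleFree (unstep _) wrapˡ      ()
CycleAdj-triangleFree (unstep _) wrapʳ      ()
CycleAdj-triangleFree wrapˡ      (step _)   ()
CycleAdj-triangleFree wrapˡ      (unstep _) ()
CycleAdj-triangleFree wrapˡ      wrapʳ      ()
CycleAdj-triangleFree wrapʳ      (step _)   ()
CycleAdj-triangleFree wrapʳ      wrapˡ      ()

CycleAdj-neighbours : ∀ {k a} → a ℕ.< 4 ℕ.+ k → ∃₂ (NeighbourPair (CycleAdj (4 ℕ.+ k)) a)
CycleAdj-neighbours {k} {zero} _ = 1 , 3 ℕ.+ k , record
  { distinct   = λ ()
  ; adjacentˡ  = step (s≤s (s≤s z≤n))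
  ; adjacentʳ  = wrapˡ
  ; exhaustive = λ { (step _) → inj₁ refl ; wrapˡ → inj₂ refl }
  }
CycleAdj-neighbours {k} {suc b} 1+b<n with ℕ.m≤n⇒m<n∨m≡n 1+b<n
... | inj₁ 2+b<n = b , suc (suc b) , record
  { distinct   = λ ()
  ; adjacentˡ  = unstep 1+b<n
  ; adjacentʳ  = step 2+b<n
  ; exhaustive = λ { (step _)   → inj₂ refl
                   ; (unstep _) → inj₁ refl
                   ; wrapʳ      → ⊥-elim (ℕ.<-irrefl refl 2+b<n)
                   }
  }
... | inj₂ refl = b , 0 , record
  { distinct   = λ ()
  ; adjacentˡ  = unstep 1+b<n
  ; adjacentʳ  = wrapʳ
  ; exhaustive = λ { (step 2+b<n) → ⊥-elim (ℕ.<-irrefl refl 2+b<n)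
                   ; (unstep _)   → inj₁ refl
                   ; wrapʳ        → inj₂ refl
                   }
  }

-- The disjunct x is explicit, as T (x ∨ y) does not determine it.
∨-introˡ : ∀ x {y} → T x → T (x ∨ y)
∨-introˡ x = Equivalence.from (T-∨ {x}) ∘ inj₁

∨-introʳ : ∀ x {y} → T y → T (x ∨ y)
∨-introʳ x = Equivalence.from (T-∨ {x}) ∘ inj₂

cycleGraph⇒CycleAdj : ∀ {n} (i j : Fin n) → T (cycleGraph n i j) → CycleAdj n (toℕ i) (toℕ j)
cycleGraph⇒CycleAdj {n} i j with toℕ i | toℕ j | toℕ<n i | toℕ<n j
... | a | b | a<n | b<n =
  [ fromStep , [ fromUnstep , [ fromWrapˡ , fromWrapʳ ]′ ∘ split ]′ ∘ split ]′ ∘ split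
  where
  split : ∀ {x y} → T (x ∨ y) → T x ⊎ T y
  split = Equivalence.to T-∨
  fromStep : T (suc a ≡ᵇ b) → CycleAdj n a b
  fromStep e with ℕ.≡ᵇ⇒≡ (suc a) b e
  ... | refl = step b<n
  fromUnstep : T (suc b ≡ᵇ a) → CycleAdj n a b
  fromUnstep e with ℕ.≡ᵇ⇒≡ (suc b) a e
  ... | refl = unstep a<n
  fromWrapˡ : T ((a ≡ᵇ 0) ∧ (suc b ≡ᵇ n)) → CycleAdj n a b
  fromWrapˡ e with Equivalence.to T-∧ e
  ... | a≡0 , 1+b≡n with ℕ.≡ᵇ⇒≡ a 0 a≡0 | ℕ.≡ᵇ⇒≡ (suc b) n 1+b≡n
  ...   | refl | refl = wrapˡ
  fromWrapʳ : T ((b ≡ᵇ 0) ∧ (suc a ≡ᵇ n)) → CycleAdj n a b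
  fromWrapʳ e with Equivalence.to T-∧ e
  ... | b≡0 , 1+a≡n with ℕ.≡ᵇ⇒≡ b 0 b≡0 | ℕ.≡ᵇ⇒≡ (suc a) n 1+a≡n
  ...   | refl | refl = wrapʳ

CycleAdj⇒cycleGraph : ∀ {n} (i j : Fin n) → CycleAdj n (toℕ i) (toℕ j) → T (cycleGraph n i j)
CycleAdj⇒cycleGraph i j adj with toℕ i | toℕ j | adj
... | a | .(suc a) | step _ =
  ∨-introˡ (suc a ≡ᵇ suc a) (ℕ.≡⇒≡ᵇ a a refl)
... | .(suc b) | b | unstep _ =
  ∨-introʳ (suc (suc b) ≡ᵇ b) (∨-introˡ (suc b ≡ᵇ suc b) (ℕ.≡⇒≡ᵇ b b refl))
... | .0 | b | wrapˡ =
  ∨-introʳ (1 ≡ᵇ b) (∨-introʳ (suc b ≡ᵇ 0)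
    (∨-introˡ ((0 ≡ᵇ 0) ∧ (suc b ≡ᵇ suc b)) (ℕ.≡⇒≡ᵇ b b refl)))
... | a | .0 | wrapʳ =
  ∨-introʳ (suc a ≡ᵇ 0) (∨-introʳ (1 ≡ᵇ a)
    (∨-introʳ ((a ≡ᵇ 0) ∧ (1 ≡ᵇ suc a)) (ℕ.≡⇒≡ᵇ a a refl)))

cycleGraph⇔CycleAdj : ∀ {n} (i j : Fin n) →
  Adjacent (cycleGraph n) i j ⇔ CycleAdj n (toℕ i) (toℕ j)
cycleGraph⇔CycleAdj i j = mk⇔
  (cycleGraph⇒CycleAdj i j ∘ Equivalence.from T-≡)
  (Equivalence.to T-≡ ∘ CycleAdj⇒cycleGraph i j)

cycleGraph-triangleFreeTwoRegular : ∀ k →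
  TriangleFreeTwoRegular (Adjacent (cycleGraph (4 ℕ.+ k)))
cycleGraph-triangleFreeTwoRegular k = record
  { symmetric    = λ {i} {j} → from j i ∘ CycleAdj-sym ∘ to i j
  ; irreflexive  = λ {i} → CycleAdj-irrefl ∘ to i i
  ; triangleFree = λ {i} {j} {l} ij jl il →
                     CycleAdj-triangleFree (to i j ij) (to j l jl) (to i l il)
  ; neighbours   = neighbours
  }
  where
  G : SeatGraph (4 ℕ.+ k)
  G = cycleGraph (4 ℕ.+ k)
  to : ∀ i j → Adjacent G i j → CycleAdj (4 ℕ.+ k) (toℕ i) (toℕ j)
  to i j = Equivalence.to (cycleGraph⇔CycleAdj i j)
  from : ∀ i j → CycleAdj (4 ℕ.+ k) (toℕ i) (toℕ j) → Adjacent G i j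
  from i j = Equivalence.from (cycleGraph⇔CycleAdj i j)
  neighbours : ∀ i → ∃₂ (NeighbourPair (Adjacent G) i)
  neighbours i with CycleAdj-neighbours (toℕ<n i)
  ... | x , y , np = fromℕ< x<n , fromℕ< y<n ,
    NeighbourPair-transport toℕ toℕ-injective (λ {p} {q} → cycleGraph⇔CycleAdj p q)
      (subst₂ (NeighbourPair _ (toℕ i)) (sym (toℕ-fromℕ< x<n)) (sym (toℕ-fromℕ< y<n)) np)
    where
    x<n : x ℕ.< 4 ℕ.+ k
    x<n = CycleAdj-<ʳ (NeighbourPair.adjacentˡ np)
    y<n : y ℕ.< 4 ℕ.+ k
    y<n = CycleAdj-<ʳ (NeighbourPair.adjacentʳ np)

lemma2 : (n : ℕ) → 4 ≤ n → (l : Fin n → ℚ) → Injective _≡_ _≡_ l →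
    (σ : Arrangement n) →
    ∃₂ λ p q → Neighbour (cycleGraph n) (Inverse.to σ) p q
    × Envies (cycleGraph n) (val1D l) (Inverse.to σ) p q
lemma2 _ (s≤s (s≤s (s≤s (s≤s (z≤n {k}))))) =
  envious-neighbours (cycleGraph-triangleFreeTwoRegular k)
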